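{- Let $p\ge 4$ be an integer and let $R_p$ be the reflector of thickness $p$ (defined in the context), with vertices $a$ and $z$ as named there. Let $f$ be a bijection from $V(R_p)$ to $\{0,1,\dots,5p\}$ with $B(f)=B(R_p)$. Then either $f(a)<p$ and $f(z)<p$, or $f(a)>4p$ and $f(z)>4p$.
   Context: For an injection $f\colon V(G)\to\mathbb{Z}$, $B(f)=\max_{uv\in E(G)}|f(u)-f(v)|$ and $B(G)=\min_f B(f)$. The reflector $R_p$ of thickness $p$ is the graph on $5p+1$ vertices defined as follows. Take a path $a,b,c_0,w,x,y,z$. Add $p-2$ leaves $a_1,\dots,a_{p-2}$ adjacent to $b$ and $p-2$ leaves $y_1,\dots,y_{p-2}$ adjacent to $x$ (so along the path the degrees are $1,p,2,2,p,2,1$). Add a clique on $p-2$ new vertices $c_1,\dots,c_{p-2}$, each adjacent to both $c_0$ and $w$. Finally add $p$ paths of length $2$ from $w$: new vertices $w_1,\dots,w_p,w_1',\dots,w_p'$ with edges $ww_i$ and $w_iw_i'$ for $1\le i\le p$. -}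

module Defs where

open import Data.Nat using (ℕ; _∸_; _⊔_; _<ᵇ_)
open import Data.Fin using (Fin; toℕ)
open import Data.Bool using (if_then_else_)
open import Data.List using (List; []; _∷_; _++_; map; concatMap; foldr; allFin)
open import Data.Product using (_×_; _,_)
open import Data.Integer using (ℤ; _-_; ∣_∣)

data RVtx (p : ℕ) : Set where
  a b c₀ w x y z : RVtx p
  aᵢ : Fin (p ∸ 2) → RVtx p
  yᵢ : Fin (p ∸ 2) → RVtx p
  cᵢ : Fin (p ∸ 2) → RVtx p
  wᵢ : Fin p → RVtx p
  wᵢ′ : Fin p → RVtx p

pathEdges : (p : ℕ) → List (RVtx p × RVtx p)
pathEdges p = (a , b) ∷ (b , c₀) ∷ (c₀ , w) ∷ (w , x) ∷ (x , y) ∷ (y , z) ∷ []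

leafEdges : (p : ℕ) → List (RVtx p × RVtx p)
leafEdges p = map (λ i → (b , aᵢ i)) (allFin (p ∸ 2))
           ++ map (λ i → (x , yᵢ i)) (allFin (p ∸ 2))

cliqueEdges : (p : ℕ) → List (RVtx p × RVtx p)
cliqueEdges p =
  concatMap (λ i → concatMap (λ j → if toℕ i <ᵇ toℕ j then (cᵢ i , cᵢ j) ∷ [] else [])
                                   (allFin (p ∸ 2)))
            (allFin (p ∸ 2))
  ++ map (λ i → (c₀ , cᵢ i)) (allFin (p ∸ 2))
  ++ map (λ i → (w , cᵢ i)) (allFin (p ∸ 2))

pendantPathEdges : (p : ℕ) → List (RVtx p × RVtx p)
pendantPathEdges p = map (λ i → (w , wᵢ i)) (allFin p)
                  ++ map (λ i → (wᵢ i , wᵢ′ i)) (allFin p)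

edges : (p : ℕ) → List (RVtx p × RVtx p)
edges p = pathEdges p ++ leafEdges p ++ cliqueEdges p ++ pendantPathEdges p

-- B(f) = max over edges uv of |f(u) - f(v)|  (the edge set is nonempty).
bandwidthOf : {V : Set} → List (V × V) → (V → ℤ) → ℕ
bandwidthOf es f = foldr (λ e m → ∣ f (Data.Product.proj₁ e) - f (Data.Product.proj₂ e) ∣ ⊔ m) 0 es

-- An optimal labelling F has bandwidth at most p, since laying the vertices out as
-- w′ᵢ, wᵢ, w, cᵢ, x, c₀, y, yᵢ, b, z, a, aᵢ achieves p. The closed neighbourhood N[w] has
-- 2p + 1 vertices, so it fills the labels [W − p, W + p], W = F w, and every other vertex
-- lies beyond them. Reflecting if necessary, F w < F x; then y and the yᵢ take all but one
-- label of the strip (W + p, W + 2p]. If F c₀ > W, b takes that label; this pushes every wᵢ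
-- below W and every w′ᵢ below W − p, so W ≥ 2p, while a and z lie beyond the strip, above
-- W + 2p ≥ 4p. If F c₀ < W, the p labels of [W − p, W) cannot hold c₀ and all wᵢ, so some wⱼ
-- lies above W; its w′ⱼ takes the spare label of the strip, which puts the other wₖ, and then
-- (by the same count) no cᵢ, below W. Now a, the aᵢ, b and the other w′ₖ crowd into
-- [F b − p, W − p), so F b + 2p ≤ W + 1, and every cᵢ, squeezed between W and F c₀ + p,
-- would be labelled W + 1, though there are p − 2 ≥ 2 of them.

{-# OPTIONS --safe #-}
module Submission where

open import Defs
open import Data.Nat using (ℕ; _≤_; _<_; _*_; suc)
open import Data.Fin using (Fin; toℕ)
open import Data.Integer using (ℤ; +_)
open import Data.Product using (_×_)
open import Data.Sum using (_⊎_)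
open import Relation.Binary.PropositionalEquality using (_≡_)
open import Function.Definitions using (Bijective; Injective)

open import Data.Bool using (true; false; T; if_then_else_)
open import Data.Empty using (⊥; ⊥-elim)
open import Data.Fin using (fromℕ<; punchIn; zero; suc; splitAt; join)
import Data.Fin.Properties as Fin
open import Data.Integer using (_⊖_; ∣_∣; _-_)
import Data.Integer.Properties as ℤ
open import Data.List using (List; []; _∷_; map; concatMap; allFin)
open import Data.List.Relation.Unary.All using (All; []; _∷_)
import Data.List.Relation.Unary.All.Properties as All
open import Data.Nat using (zero; _+_; _∸_; _≤ᵇ_; _<ᵇ_; z≤n; s≤s; _≟_; _≤?_; _<?_)
open import Data.Nat.Properties
open import Data.Nat.Tactic.RingSolver using (solve-∀)
open import Data.Product using (Σ; ∃; _,_; proj₁; proj₂)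
import Data.Product as Product
open import Data.Sum using (inj₁; inj₂; [_,_])
open import Data.Unit using (⊤; tt)
open import Data.Vec.Functional using (Vector) renaming (_∷_ to _∷ᵛ_; _++_ to _++ᵛ_)
open import Function using (_∘_; _⇔_; mk⇔; Equivalence)
open import Relation.Binary.PropositionalEquality
  using (_≢_; refl; sym; trans; cong; subst; module ≡-Reasoning)
open import Relation.Nullary using (¬_; yes; no)
open import Relation.Binary using (tri<; tri≈; tri>)

open Equivalence using (to; from)

private
  variable
    A : Set
    k m n lo hi : ℕ

Close : ℕ → ℕ → ℕ → Set
Close k m n = m ≤ n + k × n ≤ m + k

Close-sym : Close k m n → Close k n m
Close-sym (m≤n+k , n≤m+k) = n≤m+k , m≤n+k

bounded⇒Close : lo ≤ m → m ≤ lo + k → lo ≤ n → n ≤ lo + k → Close k m n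
bounded⇒Close lo≤m m≤lo+k lo≤n n≤lo+k =
  ≤-trans m≤lo+k (+-monoˡ-≤ _ lo≤n) , ≤-trans n≤lo+k (+-monoˡ-≤ _ lo≤m)

Close-reflect : ∀ {N} → m ≤ N → n ≤ N → Close k m n → Close k (N ∸ m) (N ∸ n)
Close-reflect {m} {n} {k} {N} m≤N n≤N (m≤n+k , n≤m+k) = reflect n≤m+k n≤N , reflect m≤n+k m≤N
  where
  reflect : ∀ {m n} → n ≤ m + k → n ≤ N → N ∸ m ≤ N ∸ n + k
  reflect {m} {n} n≤m+k n≤N = begin
    N ∸ m                ≡⟨ [m+n]∸[m+o]≡n∸o k N m ⟨
    (k + N) ∸ (k + m)    ≤⟨ ∸-monoʳ-≤ (k + N) (subst (n ≤_) (+-comm m k) n≤m+k) ⟩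
    (k + N) ∸ n          ≡⟨ +-∸-assoc k n≤N ⟩
    k + (N ∸ n)          ≡⟨ +-comm k (N ∸ n) ⟩
    N ∸ n + k            ∎
    where open ≤-Reasoning

4n<5n∸m⇒m<n : m ≤ 5 * n → 4 * n < 5 * n ∸ m → m < n
4n<5n∸m⇒m<n {m} {n} m≤5n 4n<5n∸m = +-cancelˡ-< (4 * n) m n (begin-strict
  4 * n + m           <⟨ +-monoˡ-< m 4n<5n∸m ⟩
  5 * n ∸ m + m       ≡⟨ m∸n+n≡m m≤5n ⟩
  n + 4 * n           ≡⟨ +-comm n (4 * n) ⟩
  4 * n + n           ∎)
  where open ≤-Reasoning

4*m≡m+m+m+m : ∀ m → 4 * m ≡ m + m + m + m
4*m≡m+m+m+m = solve-∀

private
  ∣m⊖n∣≤k⇔Close-≤ : m ≤ n → ∣ m ⊖ n ∣ ≤ k ⇔ Close k m n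
  ∣m⊖n∣≤k⇔Close-≤ {m} {n} {k} m≤n rewrite ℤ.∣⊖∣-≤ m≤n = mk⇔
    (λ n∸m≤k → ≤-trans m≤n (m≤m+n n k) , ≤-trans (m≤n+m∸n n m) (+-monoʳ-≤ m n∸m≤k))
    (λ (_ , n≤m+k) → m≤n+o⇒m∸n≤o n m n≤m+k)

∣+m-+n∣≤k⇔Close : ∀ m n k → ∣ + m - + n ∣ ≤ k ⇔ Close k m n
∣+m-+n∣≤k⇔Close m n k rewrite ℤ.m-n≡m⊖n m n with ≤-total m n
... | inj₁ m≤n = ∣m⊖n∣≤k⇔Close-≤ m≤n
... | inj₂ n≤m rewrite ℤ.∣m⊖n∣≡∣n⊖m∣ m n =
  mk⇔ (Close-sym ∘ to (∣m⊖n∣≤k⇔Close-≤ n≤m)) (from (∣m⊖n∣≤k⇔Close-≤ n≤m) ∘ Close-sym)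

Short : {V : Set} → ℕ → (V → ℕ) → V × V → Set
Short k F (u , v) = Close k (F u) (F v)

bandwidth≤⇔All-Short : ∀ {V : Set} (F : V → ℕ) k (es : List (V × V)) →
                       bandwidthOf es (λ v → + F v) ≤ k ⇔ All (Short k F) es
bandwidth≤⇔All-Short F k [] = mk⇔ (λ _ → []) (λ _ → z≤n)
bandwidth≤⇔All-Short F k ((u , v) ∷ es) = mk⇔
  (λ le → to uv (m⊔n≤o⇒m≤o _ _ le) ∷ to rest (m⊔n≤o⇒n≤o _ _ le))
  (λ { (short ∷ shorts) → ⊔-lub (from uv short) (from rest shorts) })
  where
  uv = ∣+m-+n∣≤k⇔Close (F u) (F v) k
  rest = bandwidth≤⇔All-Short F k es

Within : ℕ → ℕ → ℕ → Set
Within lo hi m = lo ≤ m × m < hi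

injective-in-interval⇒≤ : {g : Vector ℕ (suc n)} → Injective _≡_ _≡_ g →
                          (∀ i → Within lo hi (g i)) → lo + suc n ≤ hi
injective-in-interval⇒≤ {n} {lo} {hi} {g} g-injective bounds = begin
  lo + suc n         ≤⟨ +-monoʳ-≤ lo (Fin.injective⇒≤ offset-injective) ⟩
  lo + (hi ∸ lo)     ≡⟨ m+[n∸m]≡n (≤-trans (proj₁ (bounds zero)) (<⇒≤ (proj₂ (bounds zero)))) ⟩
  hi                 ∎
  where
  open ≤-Reasoning
  offset : Vector (Fin (hi ∸ lo)) (suc n)
  offset i = fromℕ< (∸-monoˡ-< (proj₂ (bounds i)) (proj₁ (bounds i)))
  offset-injective : Injective _≡_ _≡_ offset
  offset-injective {i} {j} eq = g-injective
    (∸-cancelʳ-≡ (proj₁ (bounds i)) (proj₁ (bounds j)) (Fin.fromℕ<-injective _ _ _ _ eq))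

injective-in-interval⇒⊥ : {g : Vector ℕ (suc n)} → Injective _≡_ _≡_ g →
                          ¬ (∀ i → Within lo (lo + n) (g i))
injective-in-interval⇒⊥ {n} {lo} g-injective bounds =
  1+n≰n (+-cancelˡ-≤ lo _ _ (injective-in-interval⇒≤ g-injective bounds))

module _ {v : A} {h : Vector A n} where

  ∷ᵛ⁺ : (P : A → Set) → P v → (∀ i → P (h i)) → ∀ i → P ((v ∷ᵛ h) i)
  ∷ᵛ⁺ _ pv ph zero = pv
  ∷ᵛ⁺ _ pv ph (suc i) = ph i

  ∷ᵛ-injective : (∀ i → v ≢ h i) → Injective _≡_ _≡_ h → Injective _≡_ _≡_ (v ∷ᵛ h)
  ∷ᵛ-injective v∉h h-injective {zero} {zero} _ = refl
  ∷ᵛ-injective v∉h h-injective {zero} {suc j} eq = ⊥-elim (v∉h j eq)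
  ∷ᵛ-injective v∉h h-injective {suc i} {zero} eq = ⊥-elim (v∉h i (sym eq))
  ∷ᵛ-injective v∉h h-injective {suc i} {suc j} eq = cong suc (h-injective eq)

++ᵛ⁺ : (P : A → Set) (h₁ : Vector A m) (h₂ : Vector A n) →
       (∀ i → P (h₁ i)) → (∀ i → P (h₂ i)) → ∀ i → P ((h₁ ++ᵛ h₂) i)
++ᵛ⁺ {m = m} _ _ _ p₁ p₂ i with splitAt m i
... | inj₁ i₁ = p₁ i₁
... | inj₂ i₂ = p₂ i₂

module _ {h₁ : Vector A m} {h₂ : Vector A n} where

  ++ᵛ-injective : (∀ i j → h₁ i ≢ h₂ j) → Injective _≡_ _≡_ h₁ → Injective _≡_ _≡_ h₂ →
                  Injective _≡_ _≡_ (h₁ ++ᵛ h₂)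
  ++ᵛ-injective disjoint h₁-injective h₂-injective {i} {j} eq = begin
    i                             ≡⟨ Fin.join-splitAt m n i ⟨
    join m n (splitAt m i) ≡⟨ cong (join m n) (split-injective (splitAt m i) (splitAt m j) eq) ⟩
    join m n (splitAt m j) ≡⟨ Fin.join-splitAt m n j ⟩
    j                             ∎
    where
    open ≡-Reasoning
    split-injective : ∀ s t → [ h₁ , h₂ ] s ≡ [ h₁ , h₂ ] t → s ≡ t
    split-injective (inj₁ s) (inj₁ t) eq = cong inj₁ (h₁-injective eq)
    split-injective (inj₁ s) (inj₂ t) eq = ⊥-elim (disjoint s t eq)
    split-injective (inj₂ s) (inj₁ t) eq = ⊥-elim (disjoint t s (sym eq))
    split-injective (inj₂ s) (inj₂ t) eq = cong inj₂ (h₂-injective eq)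

not-in-family : (P : A → Set) {v : A} {h : Vector A n} → (∀ i → P (h i)) → ¬ P v → ∀ i → v ≢ h i
not-in-family _ ph ¬pv i refl = ¬pv (ph i)

All-map-allFin⁺ : {P : A → Set} {f : Fin n → A} → (∀ i → P (f i)) → All P (map f (allFin n))
All-map-allFin⁺ pf = All.map⁺ (All.tabulate⁺ pf)

All-map-allFin⁻ : {P : A → Set} {f : Fin n → A} → All P (map f (allFin n)) → ∀ i → P (f i)
All-map-allFin⁻ pfs = All.tabulate⁻ (All.map⁻ pfs)

-- The edges of R_p other than those inside the clique on the cᵢ, which the argument never uses.
data Edge {p : ℕ} : RVtx p → RVtx p → Set where
  a-b    : Edge a b
  b-c₀   : Edge b c₀
  c₀-w   : Edge c₀ w
  w-x    : Edge w x
  x-y    : Edge x y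
  y-z    : Edge y z
  b-aᵢ   : ∀ i → Edge b (aᵢ i)
  x-yᵢ   : ∀ i → Edge x (yᵢ i)
  c₀-cᵢ  : ∀ i → Edge c₀ (cᵢ i)
  w-cᵢ   : ∀ i → Edge w (cᵢ i)
  w-wᵢ   : ∀ i → Edge w (wᵢ i)
  wᵢ-wᵢ′ : ∀ i → Edge (wᵢ i) (wᵢ′ i)

module _ {p : ℕ} {P : RVtx p × RVtx p → Set} where

  All-edges⁺ : (∀ {u v} → Edge u v → P (u , v)) → (∀ i j → P (cᵢ i , cᵢ j)) → All P (edges p)
  All-edges⁺ edge clique =
    All.++⁺ (edge a-b ∷ edge b-c₀ ∷ edge c₀-w ∷ edge w-x ∷ edge x-y ∷ edge y-z ∷ [])
    (All.++⁺ (All.++⁺ (All-map-allFin⁺ (edge ∘ b-aᵢ)) (All-map-allFin⁺ (edge ∘ x-yᵢ)))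
    (All.++⁺ (All.++⁺ clique-interior
                      (All.++⁺ (All-map-allFin⁺ (edge ∘ c₀-cᵢ)) (All-map-allFin⁺ (edge ∘ w-cᵢ))))
             (All.++⁺ (All-map-allFin⁺ (edge ∘ w-wᵢ)) (All-map-allFin⁺ (edge ∘ wᵢ-wᵢ′)))))
    where
    ordered-pair : ∀ i j → All P (if toℕ i <ᵇ toℕ j then (cᵢ i , cᵢ j) ∷ [] else [])
    ordered-pair i j with toℕ i <ᵇ toℕ j
    ... | true = clique i j ∷ []
    ... | false = []
    clique-interior = All.concat⁺ (All-map-allFin⁺ λ i → All.concat⁺ (All-map-allFin⁺ (ordered-pair i)))

  All-edges⁻ : All P (edges p) → ∀ {u v} → Edge u v → P (u , v)
  All-edges⁻ all-edges = edge (All.++⁻ˡ (pathEdges p) all-edges)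
    where
    rest₁ = All.++⁻ʳ (pathEdges p) all-edges
    leaves = All.++⁻ˡ (leafEdges p) rest₁
    rest₂ = All.++⁻ʳ (leafEdges p) rest₁
    attached = All.++⁻ʳ (concatMap _ (allFin (p ∸ 2))) (All.++⁻ˡ (cliqueEdges p) rest₂)
    pendant = All.++⁻ʳ (cliqueEdges p) rest₂
    edge : All P (pathEdges p) → ∀ {u v} → Edge u v → P (u , v)
    edge (ab ∷ _) a-b = ab
    edge (_ ∷ bc ∷ _) b-c₀ = bc
    edge (_ ∷ _ ∷ cw ∷ _) c₀-w = cw
    edge (_ ∷ _ ∷ _ ∷ wx ∷ _) w-x = wx
    edge (_ ∷ _ ∷ _ ∷ _ ∷ xy ∷ _) x-y = xy
    edge (_ ∷ _ ∷ _ ∷ _ ∷ _ ∷ yz ∷ _) y-z = yz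
    edge _ (b-aᵢ i) = All-map-allFin⁻ (All.++⁻ˡ _ leaves) i
    edge _ (x-yᵢ i) = All-map-allFin⁻ (All.++⁻ʳ _ leaves) i
    edge _ (c₀-cᵢ i) = All-map-allFin⁻ (All.++⁻ˡ _ attached) i
    edge _ (w-cᵢ i) = All-map-allFin⁻ (All.++⁻ʳ _ attached) i
    edge _ (w-wᵢ i) = All-map-allFin⁻ (All.++⁻ˡ _ pendant) i
    edge _ (wᵢ-wᵢ′ i) = All-map-allFin⁻ (All.++⁻ʳ _ pendant) i

module Consecutive (size : ℕ → ℕ) where

  base : ℕ → ℕ
  base zero = 0
  base (suc t) = base t + size t

  span : ℕ → ℕ → ℕ
  span t zero = 0
  span t (suc d) = size t + span (suc t) d

  base-+ : ∀ t d → base (t + d) ≡ base t + span t d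
  base-+ t zero = trans (cong base (+-identityʳ t)) (sym (+-identityʳ (base t)))
  base-+ t (suc d) = begin
    base (t + suc d)                  ≡⟨ cong base (+-suc t d) ⟩
    base (suc t + d)                  ≡⟨ base-+ (suc t) d ⟩
    base t + size t + span (suc t) d  ≡⟨ +-assoc (base t) (size t) _ ⟩
    base t + span t (suc d)           ∎
    where open ≡-Reasoning

  base-mono : ∀ {t t′} → t ≤ t′ → base t ≤ base t′
  base-mono {t} {t′} t≤t′ = begin
    base t                     ≤⟨ m≤m+n (base t) _ ⟩
    base t + span t (t′ ∸ t)   ≡⟨ base-+ t (t′ ∸ t) ⟨
    base (t + (t′ ∸ t))        ≡⟨ cong base (m+[n∸m]≡n t≤t′) ⟩
    base t′                    ∎
    where open ≤-Reasoning

  Slot : Set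
  Slot = Σ ℕ (Fin ∘ size)

  place : Slot → ℕ
  place (t , o) = base t + toℕ o

  place<base : ∀ t (o : Fin (size t)) → place (t , o) < base (suc t)
  place<base t o = +-monoʳ-< (base t) (Fin.toℕ<n o)

  place-< : ∀ {t t′} {o : Fin (size t)} {o′ : Fin (size t′)} → t < t′ → place (t , o) < place (t′ , o′)
  place-< t<t′ = <-≤-trans (place<base _ _) (≤-trans (base-mono t<t′) (m≤m+n _ _))

  place-injective : Injective _≡_ _≡_ place
  place-injective {t , o} {t′ , o′} eq with <-cmp t t′
  ... | tri< t<t′ _ _ = ⊥-elim (<-irrefl eq (place-< t<t′))
  ... | tri≈ _ refl _ = cong (t ,_) (Fin.toℕ-injective (+-cancelˡ-≡ (base t) _ _ eq))
  ... | tri> _ _ t′<t = ⊥-elim (<-irrefl (sym eq) (place-< t′<t))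

  place-Close : ∀ t d (o : Fin (size t)) (o′ : Fin (size (t + d))) →
                span t (suc d) ≤ suc k → Close k (place (t , o)) (place (t + d , o′))
  place-Close {k} t d o o′ span≤1+k =
    bounded⇒Close (m≤m+n (base t) _)
                  (before-end (<-≤-trans (place<base t o) (base-mono (s≤s (m≤m+n t d)))))
                  (≤-trans (base-mono (m≤m+n t d)) (m≤m+n _ _))
                  (before-end (place<base (t + d) o′))
    where
    open ≤-Reasoning
    before-end : ∀ {m} → m < base (suc (t + d)) → m ≤ base t + k
    before-end {m} m<end = ≤-pred (begin
      suc m                    ≤⟨ m<end ⟩
      base (suc (t + d))       ≡⟨ cong base (+-suc t d) ⟨
      base (t + suc d)         ≡⟨ base-+ t (suc d) ⟩
      base t + span t (suc d)  ≤⟨ +-monoʳ-≤ (base t) span≤1+k ⟩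
      base t + suc k           ≡⟨ +-suc (base t) k ⟩
      suc (base t + k)         ∎)

module Layout (s : ℕ) where

  private
    p : ℕ
    p = 2 + s

  size : ℕ → ℕ
  size 0  = p
  size 1  = p
  size 2  = 1
  size 3  = s
  size 4  = 1
  size 5  = 1
  size 6  = 1
  size 7  = s
  size 8  = 1
  size 9  = 1
  size 10 = 1
  size 11 = s
  size _  = 0

  open Consecutive size

  slot : RVtx p → Slot
  slot (wᵢ′ i) = 0  , i
  slot (wᵢ i)  = 1  , i
  slot w       = 2  , zero
  slot (cᵢ i)  = 3  , i
  slot x       = 4  , zero
  slot c₀      = 5  , zero
  slot y       = 6  , zero
  slot (yᵢ i)  = 7  , i
  slot b       = 8  , zero
  slot z       = 9  , zero
  slot a       = 10 , zero
  slot (aᵢ i)  = 11 , i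

  vertexAt : Slot → RVtx p
  vertexAt (0  , i) = wᵢ′ i
  vertexAt (1  , i) = wᵢ i
  vertexAt (2  , _) = w
  vertexAt (3  , i) = cᵢ i
  vertexAt (4  , _) = x
  vertexAt (5  , _) = c₀
  vertexAt (6  , _) = y
  vertexAt (7  , i) = yᵢ i
  vertexAt (8  , _) = b
  vertexAt (9  , _) = z
  vertexAt (10 , _) = a
  vertexAt (11 , i) = aᵢ i
  vertexAt (suc (suc (suc (suc (suc (suc (suc (suc (suc (suc (suc (suc _))))))))))) , ())

  vertexAt-slot : ∀ v → vertexAt (slot v) ≡ v
  vertexAt-slot (wᵢ′ _) = refl
  vertexAt-slot (wᵢ _)  = refl
  vertexAt-slot w       = refl
  vertexAt-slot (cᵢ _)  = refl
  vertexAt-slot x       = refl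
  vertexAt-slot c₀      = refl
  vertexAt-slot y       = refl
  vertexAt-slot (yᵢ _)  = refl
  vertexAt-slot b       = refl
  vertexAt-slot z       = refl
  vertexAt-slot a       = refl
  vertexAt-slot (aᵢ _)  = refl

  layout : RVtx p → ℕ
  layout = place ∘ slot

  layout-injective : Injective _≡_ _≡_ layout
  layout-injective {u} {v} eq = begin
    u                   ≡⟨ vertexAt-slot u ⟨
    vertexAt (slot u)   ≡⟨ cong vertexAt (place-injective eq) ⟩
    vertexAt (slot v)   ≡⟨ vertexAt-slot v ⟩
    v                   ∎
    where open ≡-Reasoning

  private
    -- a run of i unit blocks, one block of size s and j unit blocks
    fits : ∀ i j → {T (i + j ≤ᵇ 3)} → i + (s + j) ≤ suc p
    fits i j {i+j≤3} = begin
      i + (s + j)   ≡⟨ +-assoc i s j ⟨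
      i + s + j     ≡⟨ cong (_+ j) (+-comm i s) ⟩
      s + i + j     ≡⟨ +-assoc s i j ⟩
      s + (i + j)   ≤⟨ +-monoʳ-≤ s (≤ᵇ⇒≤ (i + j) 3 i+j≤3) ⟩
      s + 3         ≡⟨ +-comm s 3 ⟩
      3 + s         ∎
      where open ≤-Reasoning

  layout-Short : ∀ {u v} → Edge u v → Close p (layout u) (layout v)
  layout-Short a-b        = Close-sym (place-Close 8 2 zero zero (m≤m+n 3 s))
  layout-Short b-c₀       = Close-sym (place-Close 5 3 zero zero (fits 2 1))
  layout-Short c₀-w       = Close-sym (place-Close 2 3 zero zero (fits 1 2))
  layout-Short w-x        = place-Close 2 2 zero zero (fits 1 1)
  layout-Short x-y        = place-Close 4 2 zero zero (m≤m+n 3 s)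
  layout-Short y-z        = place-Close 6 3 zero zero (fits 1 2)
  layout-Short (b-aᵢ i)   = place-Close 8 3 zero i (fits 3 0)
  layout-Short (x-yᵢ i)   = place-Close 4 3 zero i (fits 3 0)
  layout-Short (c₀-cᵢ i)  = Close-sym (place-Close 3 2 i zero (fits 0 2))
  layout-Short (w-cᵢ i)   = place-Close 2 1 zero i (fits 1 0)
  layout-Short (w-wᵢ i)   = Close-sym (place-Close 1 1 i zero (fits 2 1))
  -- blocks 0 and 1 have size p, and wᵢ′, wᵢ sit at the same offset in them
  layout-Short (wᵢ-wᵢ′ i) = ≤-reflexive (+-comm p (toℕ i)) , ≤-trans (m≤n+m (toℕ i) p) (m≤m+n _ p)

  layout-clique : ∀ i j → Close p (layout (cᵢ i)) (layout (cᵢ j))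
  layout-clique i j = place-Close 3 0 i j (fits 0 0)

  layout-bandwidth : bandwidthOf (edges p) (λ v → + layout v) ≤ p
  layout-bandwidth =
    from (bandwidth≤⇔All-Short layout p (edges p)) (All-edges⁺ layout-Short layout-clique)

module Reflector (q : ℕ) where

  p : ℕ
  p = 4 + q

  module _ (F : RVtx p → ℕ) (F-injective : Injective _≡_ _≡_ F)
           (short : ∀ {u v} → Edge u v → Close p (F u) (F v)) (w<x : F w < F x) where

    private
      W : ℕ
      W = F w

      short′ : ∀ {u v} → Edge u v → Close p (F v) (F u)
      short′ = Close-sym ∘ short

      -- windows left of W are counted through F + p, avoiding truncated subtraction
      F+p : RVtx p → ℕ
      F+p v = F v + p

      F+p-injective : Injective _≡_ _≡_ F+p
      F+p-injective = F-injective ∘ +-cancelʳ-≡ p _ _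

      separate : ∀ {u v} → u ≢ v → F u < F v ⊎ F v < F u
      separate {u} {v} u≢v with <-cmp (F u) (F v)
      ... | tri< Fu<Fv _ _ = inj₁ Fu<Fv
      ... | tri≈ _ Fu≡Fv _ = ⊥-elim (u≢v (F-injective Fu≡Fv))
      ... | tri> _ _ Fv<Fu = inj₂ Fv<Fu

      cᵢ-injective : Injective _≡_ _≡_ (cᵢ {p})
      cᵢ-injective refl = refl

      wᵢ-injective : Injective _≡_ _≡_ (wᵢ {p})
      wᵢ-injective refl = refl

      wᵢ′-injective : Injective _≡_ _≡_ (wᵢ′ {p})
      wᵢ′-injective refl = refl

      yᵢ-injective : Injective _≡_ _≡_ (yᵢ {p})
      yᵢ-injective refl = refl

      aᵢ-injective : Injective _≡_ _≡_ (aᵢ {p})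
      aᵢ-injective refl = refl

      InN[w] : RVtx p → Set
      InN[w] w      = ⊤
      InN[w] c₀     = ⊤
      InN[w] x      = ⊤
      InN[w] (cᵢ _) = ⊤
      InN[w] (wᵢ _) = ⊤
      InN[w] _      = ⊥

      N[w] : Vector (RVtx p) (suc (p + p))
      N[w] = w ∷ᵛ c₀ ∷ᵛ x ∷ᵛ (cᵢ ++ᵛ wᵢ)

      N[w]-injective : Injective _≡_ _≡_ N[w]
      N[w]-injective =
        ∷ᵛ-injective (∷ᵛ⁺ (w ≢_) (λ ()) (∷ᵛ⁺ (w ≢_) (λ ()) (++ᵛ⁺ (w ≢_) cᵢ wᵢ (λ _ ()) (λ _ ()))))
        (∷ᵛ-injective (∷ᵛ⁺ (c₀ ≢_) (λ ()) (++ᵛ⁺ (c₀ ≢_) cᵢ wᵢ (λ _ ()) (λ _ ())))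
        (∷ᵛ-injective (++ᵛ⁺ (x ≢_) cᵢ wᵢ (λ _ ()) (λ _ ()))
        (++ᵛ-injective (λ _ _ ()) cᵢ-injective wᵢ-injective)))

      N[w]⊆InN[w] : ∀ i → InN[w] (N[w] i)
      N[w]⊆InN[w] = ∷ᵛ⁺ InN[w] tt (∷ᵛ⁺ InN[w] tt (∷ᵛ⁺ InN[w] tt (++ᵛ⁺ InN[w] cᵢ wᵢ _ _)))

      Near-w : RVtx p → Set
      Near-w v = Close p W (F v)

      N[w]-near : ∀ i → Near-w (N[w] i)
      N[w]-near = ∷ᵛ⁺ Near-w (m≤m+n W p , m≤m+n W p) (∷ᵛ⁺ Near-w (short′ c₀-w)
                  (∷ᵛ⁺ Near-w (short w-x) (++ᵛ⁺ Near-w cᵢ wᵢ (short ∘ w-cᵢ) (short ∘ w-wᵢ))))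

      only-N[w]-near : ∀ {v} → ¬ InN[w] v → ¬ Near-w v
      -- v and N[w] would be 2p + 2 vertices labelled in [W − p, W + p]
      only-N[w]-near {v} v∉N[w] v-near = injective-in-interval⇒⊥
        (∷ᵛ-injective (not-in-family InN[w] N[w]⊆InN[w] v∉N[w]) N[w]-injective ∘ F+p-injective)
        (∷ᵛ⁺ (Within W (W + suc (p + p)) ∘ F+p) (window v-near) (window ∘ N[w]-near))
        where
        window : ∀ {m} → Close p W m → Within W (W + suc (p + p)) (m + p)
        window {m} (W≤m+p , m≤W+p) = W≤m+p , (begin-strict
          m + p            ≤⟨ +-monoˡ-≤ p m≤W+p ⟩
          W + p + p        ≡⟨ +-assoc W p p ⟩
          W + (p + p)      <⟨ +-monoʳ-< W (n<1+n (p + p)) ⟩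
          W + suc (p + p)  ∎)
          where open ≤-Reasoning

      right-of-N[w] : ∀ {v} → ¬ InN[w] v → W < F v + p → W + p < F v
      right-of-N[w] v∉N[w] W<Fv+p = ≰⇒> λ Fv≤W+p → only-N[w]-near v∉N[w] (<⇒≤ W<Fv+p , Fv≤W+p)

      left-of-N[w] : ∀ {v} → ¬ InN[w] v → F v < W + p → F v + p < W
      left-of-N[w] v∉N[w] Fv<W+p = ≰⇒> λ W≤Fv+p → only-N[w]-near v∉N[w] (W≤Fv+p , <⇒≤ Fv<W+p)

      RightStrip : RVtx p → Set
      RightStrip v = W + p < F v × F v ≤ W + p + p

      LeftStrip : RVtx p → Set
      LeftStrip v = F v + p < W × W ≤ F v + p + p

      RightStrip-via : ∀ {t u} → Near-w t → W < F t → Close p (F t) (F u) → ¬ InN[w] u → RightStrip u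
      RightStrip-via (_ , Ft≤W+p) W<Ft (Ft≤Fu+p , Fu≤Ft+p) u∉N[w] =
        right-of-N[w] u∉N[w] (<-≤-trans W<Ft Ft≤Fu+p) , ≤-trans Fu≤Ft+p (+-monoˡ-≤ p Ft≤W+p)

      LeftStrip-via : ∀ {t u} → Near-w t → F t < W → Close p (F t) (F u) → ¬ InN[w] u → LeftStrip u
      LeftStrip-via (W≤Ft+p , _) Ft<W (Ft≤Fu+p , Fu≤Ft+p) u∉N[w] =
        left-of-N[w] u∉N[w] (≤-<-trans Fu≤Ft+p (+-monoˡ-< p Ft<W)) , ≤-trans W≤Ft+p (+-monoˡ-≤ p Ft≤Fu+p)

      InY : RVtx p → Set
      InY y      = ⊤
      InY (yᵢ _) = ⊤
      InY _      = ⊥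

      Y : Vector (RVtx p) (suc (p ∸ 2))
      Y = y ∷ᵛ yᵢ

      Y⊆InY : ∀ i → InY (Y i)
      Y⊆InY = ∷ᵛ⁺ InY tt _

      Y-right : ∀ i → RightStrip (Y i)
      Y-right = ∷ᵛ⁺ RightStrip (RightStrip-via (short w-x) w<x (short x-y) (λ ()))
                               (λ i → RightStrip-via (short w-x) w<x (short (x-yᵢ i)) (λ ()))

      -- y and the yᵢ already take p − 1 of the p labels of the strip
      RightStrip-unique : ∀ {u v} → ¬ InY u → ¬ InY v → RightStrip u → RightStrip v → u ≡ v
      RightStrip-unique {u} {v} u∉Y v∉Y u-right v-right with F u ≟ F v
      ... | yes Fu≡Fv = F-injective Fu≡Fv
      ... | no Fu≢Fv = ⊥-elim (injective-in-interval⇒⊥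
        (∷ᵛ-injective (∷ᵛ⁺ (u ≢_) (Fu≢Fv ∘ cong F) (not-in-family InY Y⊆InY u∉Y))
          (∷ᵛ-injective (not-in-family InY Y⊆InY v∉Y) (∷ᵛ-injective (λ _ ()) yᵢ-injective))
         ∘ F-injective)
        (∷ᵛ⁺ (Within (suc (W + p)) (suc (W + p) + p) ∘ F) (window u-right)
          (∷ᵛ⁺ (Within (suc (W + p)) (suc (W + p) + p) ∘ F) (window v-right) (window ∘ Y-right))))
        where
        window : ∀ {v} → RightStrip v → Within (suc (W + p)) (suc (W + p) + p) (F v)
        window (W+p<Fv , Fv≤W+p+p) = W+p<Fv , s≤s Fv≤W+p+p

      LeftHalf : RVtx p → Set
      LeftHalf v = F v < W × W ≤ F v + p

      LeftHalf-overfull : {h : Vector (RVtx p) (suc p)} → Injective _≡_ _≡_ h → ¬ (∀ i → LeftHalf (h i))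
      LeftHalf-overfull h-injective left = injective-in-interval⇒⊥ (h-injective ∘ F+p-injective)
        λ i → proj₂ (left i) , +-monoˡ-< p (proj₁ (left i))

    module _ (W<c₀ : W < F c₀) where

      private
        b-right : RightStrip b
        b-right = RightStrip-via (short′ c₀-w) W<c₀ (short′ b-c₀) (λ ())

        only-b : ∀ {v} → ¬ InY v → RightStrip v → b ≡ v
        only-b v∉Y = RightStrip-unique (λ ()) v∉Y b-right

        wᵢ-left : ∀ i → F (wᵢ i) < W
        wᵢ-left i with separate {wᵢ i} {w} (λ ())
        ... | inj₁ wᵢ<W = wᵢ<W
        ... | inj₂ W<wᵢ
          with only-b (λ ()) (RightStrip-via (short (w-wᵢ i)) W<wᵢ (short (wᵢ-wᵢ′ i)) (λ ()))
        ...   | ()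

        2p≤W : p + p ≤ W
        2p≤W = injective-in-interval⇒≤ (wᵢ′-injective ∘ F+p-injective) λ i →
          m≤n+m p _ , proj₁ (LeftStrip-via (short (w-wᵢ i)) (wᵢ-left i) (short (wᵢ-wᵢ′ i)) (λ ()))

        beyond-RightStrip : ∀ {v} → ¬ InN[w] v → ¬ InY v → b ≢ v → W < F v + p → 4 * p < F v
        beyond-RightStrip {v} v∉N[w] v∉Y b≢v W<Fv+p with F v ≤? W + p + p
        ... | yes Fv≤W+2p = ⊥-elim (b≢v (only-b v∉Y (right-of-N[w] v∉N[w] W<Fv+p , Fv≤W+2p)))
        ... | no Fv≰W+2p = begin-strict
          4 * p           ≡⟨ 4*m≡m+m+m+m p ⟩
          p + p + p + p   ≤⟨ +-monoˡ-≤ p (+-monoˡ-≤ p 2p≤W) ⟩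
          W + p + p       <⟨ ≰⇒> Fv≰W+2p ⟩
          F v             ∎
          where open ≤-Reasoning

      c₀-right⇒ends-far : 4 * p < F a × 4 * p < F z
      c₀-right⇒ends-far =
        beyond-RightStrip (λ ()) (λ ()) (λ ())
          (≤-<-trans (m≤m+n W p) (<-≤-trans (proj₁ b-right) (proj₂ (short a-b)))) ,
        beyond-RightStrip (λ ()) (λ ()) (λ ())
          (≤-<-trans (m≤m+n W p) (<-≤-trans (proj₁ (Y-right zero)) (proj₁ (short y-z))))

    module _ (c₀<W : F c₀ < W) where

      private
        c₀-left : LeftHalf c₀
        c₀-left = c₀<W , proj₂ (short c₀-w)

        some-wᵢ-right : ∃ λ j → W < F (wᵢ j)
        some-wᵢ-right with Fin.any? (λ j → W <? F (wᵢ j))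
        ... | yes found = found
        ... | no none = ⊥-elim (LeftHalf-overfull (∷ᵛ-injective (λ _ ()) wᵢ-injective)
                                  (∷ᵛ⁺ LeftHalf c₀-left λ j → wᵢ-left j , proj₁ (short (w-wᵢ j))))
          where
          wᵢ-left : ∀ j → F (wᵢ j) < W
          wᵢ-left j with separate {wᵢ j} {w} (λ ())
          ... | inj₁ wⱼ<W = wⱼ<W
          ... | inj₂ W<wⱼ = ⊥-elim (none (j , W<wⱼ))

      module _ {j : Fin p} (W<wⱼ : W < F (wᵢ j)) where

        private
          other-w : Vector (RVtx p) (p ∸ 1)
          other-w = wᵢ ∘ punchIn j

          other-w′ : Vector (RVtx p) (p ∸ 1)
          other-w′ = wᵢ′ ∘ punchIn j

          w′ⱼ-right : RightStrip (wᵢ′ j)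
          w′ⱼ-right = RightStrip-via (short (w-wᵢ j)) W<wⱼ (short (wᵢ-wᵢ′ j)) (λ ())

          other-w-left : ∀ k → F (other-w k) < W
          other-w-left k with separate {other-w k} {w} (λ ())
          ... | inj₁ wₖ<W = wₖ<W
          ... | inj₂ W<wₖ = ⊥-elim (Fin.punchInᵢ≢i j k (wᵢ′-injective (RightStrip-unique (λ ()) (λ ())
                  (RightStrip-via (short (w-wᵢ _)) W<wₖ (short (wᵢ-wᵢ′ _)) (λ ())) w′ⱼ-right)))

          cᵢ-right : ∀ i → W < F (cᵢ i)
          cᵢ-right i with separate {w} {cᵢ i} (λ ())
          ... | inj₁ W<cᵢ = W<cᵢ
          ... | inj₂ cᵢ<W = ⊥-elim (LeftHalf-overfull
                  (∷ᵛ-injective (∷ᵛ⁺ (c₀ ≢_) (λ ()) (λ _ ()))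
                    (∷ᵛ-injective (λ _ ()) (Fin.punchIn-injective j _ _ ∘ wᵢ-injective)))
                  (∷ᵛ⁺ LeftHalf c₀-left (∷ᵛ⁺ LeftHalf (cᵢ<W , proj₁ (short (w-cᵢ i)))
                    λ k → other-w-left k , proj₁ (short (w-wᵢ _)))))

          b-left : LeftStrip b
          b-left = LeftStrip-via (short′ c₀-w) c₀<W (short′ b-c₀) (λ ())

          other-w′-left : ∀ k → LeftStrip (other-w′ k)
          other-w′-left k = LeftStrip-via (short (w-wᵢ _)) (other-w-left k) (short (wᵢ-wᵢ′ _)) (λ ())

          -- a, the aᵢ, b and the other w′ₖ are 2p − 1 vertices labelled in [F b − p, W − p)
          b+2p≤1+W : F b + (p + p) ≤ suc W
          b+2p≤1+W = ≤-trans (≤-reflexive (+-suc (F b) _))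
                             (s≤s (injective-in-interval⇒≤ family-injective family-window))
            where
            family : Vector (RVtx p) _
            family = (a ∷ᵛ aᵢ) ++ᵛ (b ∷ᵛ other-w′)
            family-injective : Injective _≡_ _≡_ (F+p ∘ family)
            family-injective =
              ++ᵛ-injective (λ { zero zero (); zero (suc _) (); (suc _) zero (); (suc _) (suc _) () })
              (∷ᵛ-injective (λ _ ()) aᵢ-injective)
              (∷ᵛ-injective (λ _ ()) (Fin.punchIn-injective j _ _ ∘ wᵢ′-injective)) ∘ F+p-injective
            near-b : ∀ {v} → ¬ InN[w] v → Close p (F v) (F b) → Within (F b) W (F+p v)
            near-b v∉N[w] (Fv≤Fb+p , Fb≤Fv+p) =
              Fb≤Fv+p , left-of-N[w] v∉N[w] (<-≤-trans (≤-<-trans Fv≤Fb+p (proj₁ b-left)) (m≤m+n W p))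
            in-LeftStrip : ∀ {v} → LeftStrip v → Within (F b) W (F+p v)
            in-LeftStrip (Fv+p<W , W≤Fv+2p) =
              <⇒≤ (+-cancelʳ-< p (F b) _ (<-≤-trans (proj₁ b-left) W≤Fv+2p)) , Fv+p<W
            family-window : ∀ i → Within (F b) W (F+p (family i))
            family-window = ++ᵛ⁺ (Within (F b) W ∘ F+p) (a ∷ᵛ aᵢ) (b ∷ᵛ other-w′)
              (∷ᵛ⁺ (Within (F b) W ∘ F+p) (near-b (λ ()) (short a-b))
                                          (λ i → near-b (λ ()) (short′ (b-aᵢ i))))
              (∷ᵛ⁺ (Within (F b) W ∘ F+p) (in-LeftStrip b-left) (in-LeftStrip ∘ other-w′-left))

          cᵢ≡1+W : ∀ i → F (cᵢ i) ≡ suc W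
          cᵢ≡1+W i = ≤-antisym (begin
            F (cᵢ i)        ≤⟨ proj₂ (short (c₀-cᵢ i)) ⟩
            F c₀ + p        ≤⟨ +-monoˡ-≤ p (proj₂ (short b-c₀)) ⟩
            F b + p + p     ≡⟨ +-assoc (F b) p p ⟩
            F b + (p + p)   ≤⟨ b+2p≤1+W ⟩
            suc W           ∎) (cᵢ-right i)
            where open ≤-Reasoning

        wⱼ-right⇒⊥ : ⊥
        wⱼ-right⇒⊥ =
          Fin.0≢1+n (cᵢ-injective (F-injective (trans (cᵢ≡1+W zero) (sym (cᵢ≡1+W (suc zero))))))

      c₀-left⇒⊥ : ⊥
      c₀-left⇒⊥ = wⱼ-right⇒⊥ (proj₂ some-wᵢ-right)

    ends-far-right : 4 * p < F a × 4 * p < F z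
    ends-far-right with separate {c₀} {w} (λ ())
    ... | inj₁ c₀<W = ⊥-elim (c₀-left⇒⊥ c₀<W)
    ... | inj₂ W<c₀ = c₀-right⇒ends-far W<c₀

  ends-same-side : (F : RVtx p → ℕ) → Injective _≡_ _≡_ F → (∀ {u v} → Edge u v → Close p (F u) (F v)) →
                   (∀ v → F v ≤ 5 * p) → (F a < p × F z < p) ⊎ (4 * p < F a × 4 * p < F z)
  ends-same-side F F-injective short F≤5p with <-cmp (F w) (F x)
  ... | tri< w<x _ _ = inj₂ (ends-far-right F F-injective short w<x)
  ... | tri≈ _ w≡x _ with F-injective w≡x
  ...   | ()
  ends-same-side F F-injective short F≤5p | tri> _ _ x<w =
    inj₁ (Product.map (4n<5n∸m⇒m<n (F≤5p a)) (4n<5n∸m⇒m<n (F≤5p z))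
           (ends-far-right mirror mirror-injective mirror-short (∸-monoʳ-< x<w (F≤5p w))))
    where
    mirror : RVtx p → ℕ
    mirror v = 5 * p ∸ F v
    mirror-injective : Injective _≡_ _≡_ mirror
    mirror-injective eq = F-injective (∸-cancelˡ-≡ (F≤5p _) (F≤5p _) eq)
    mirror-short : ∀ {u v} → Edge u v → Close p (mirror u) (mirror v)
    mirror-short e = Close-reflect (F≤5p _) (F≤5p _) (short e)

lemma4 : (p : ℕ) → 4 ≤ p → (f : RVtx p → Fin (suc (5 * p))) → Bijective _≡_ _≡_ f
    → ((g : RVtx p → ℤ) → Injective _≡_ _≡_ g
         → bandwidthOf (edges p) (λ v → + toℕ (f v)) ≤ bandwidthOf (edges p) g)
    → (toℕ (f a) < p × toℕ (f z) < p) ⊎ (4 * p < toℕ (f a) × 4 * p < toℕ (f z))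
lemma4 (suc (suc (suc (suc q)))) (s≤s (s≤s (s≤s (s≤s _)))) f f-bijective f-optimal =
  ends-same-side (toℕ ∘ f) (proj₁ f-bijective ∘ Fin.toℕ-injective) (All-edges⁻ short-edges)
                 (λ v → ≤-pred (Fin.toℕ<n (f v)))
  where
  open Reflector q
  open Layout (2 + q)
  short-edges : All (Short p (toℕ ∘ f)) (edges p)
  short-edges = to (bandwidth≤⇔All-Short (toℕ ∘ f) p (edges p))
    (≤-trans (f-optimal (λ v → + layout v) (layout-injective ∘ ℤ.+-injective)) layout-bandwidth)
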